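{- Let $m\geqslant 3$, $n\geqslant 3$ be odd integers, $n=2n_0+1$. Let $X=\{x_{i,j}\}$ be a bicentrally balanced $C_4$-face-magic projective labeling on $\mathcal{P}_{m,n}$ and let $\delta:\{1,\ldots,n_0\}\to\{0,1\}$. Define $Z=\{z_{i,j}\}$ by, for $1\leqslant i\leqslant m$ and $1\leqslant j\leqslant n_0$, $z_{i,j}=x_{i,(1-\delta(j))j+\delta(j)(n+1-j)}$ and $z_{i,n+1-j}=x_{i,\delta(j)j+(1-\delta(j))(n+1-j)}$ (and $z_{i,n_0+1}=x_{i,n_0+1}$), i.e. the labels of rows $j$ and $n+1-j$ are swapped exactly when $\delta(j)=1$. Then $Z$ is a bicentrally balanced $C_4$-face-magic projective labeling on $\mathcal{P}_{m,n}$.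
   Context: For integers $m,n\geqslant 2$, the projective grid graph $\mathcal{P}_{m,n}$ has vertex set $\{(i,j):1\leqslant i\leqslant m,\ 1\leqslant j\leqslant n\}$ and edges $(i,j)$–$(i,j+1)$ ($j\leqslant n-1$), $(i,n)$–$(m+1-i,1)$, $(i,j)$–$(i+1,j)$ ($i\leqslant m-1$), $(m,j)$–$(1,n+1-j)$, embedded naturally in the projective plane. Its 4-cycle faces are $\{(i,j),(i+1,j),(i,j+1),(i+1,j+1)\}$ ($1\leqslant i\leqslant m-1$, $1\leqslant j\leqslant n-1$), $\{(i,n),(i+1,n),(m+1-i,1),(m-i,1)\}$ ($1\leqslant i\leqslant m-1$), and $\{(m,j),(m,j+1),(1,n+1-j),(1,n-j)\}$ ($1\leqslant j\leqslant n-1$); the other two faces are digons. A $C_4$-face-magic projective labeling is a bijection $(i,j)\mapsto x_{i,j}$ onto $\{1,\ldots,mn\}$ such that every 4-cycle face has the same label sum (the $C_4$-face-magic value). For odd $m,n$ let $S(i,j)=\tfrac12 mn+\tfrac32$ if $i+j$ is even and $S(i,j)=\tfrac32 mn+\tfrac32$ if $i+j$ is odd; a $C_4$-face-magic projective labeling with value $2mn+3$ is bicentrally balanced if $x_{i,j}+x_{m+1-i,n+1-j}=S(i,j)$ for all $(i,j)$. Row $j$ means the vertices $(i,j)$, $1\leqslant i\leqslant m$. -}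

module Defs where

open import Data.Nat using (ℕ; zero; suc; _+_; _*_; _∸_; _≤_; _<_)
open import Data.Bool using (Bool; true; false; if_then_else_)
open import Data.Product using (_×_; ∃-syntax)
open import Relation.Binary.PropositionalEquality using (_≡_)
open import Relation.Nullary.Decidable using (⌊_⌋)
open import Data.Nat using (_≤?_)
open import Data.Bool using (_∧_)

-- A labeling of the vertices (i , j), 1 ≤ i ≤ m, 1 ≤ j ≤ n, of P_{m,n}
-- is represented as a function x : ℕ → ℕ → ℕ, x i j = x_{i,j};
-- values outside the vertex range are irrelevant.
Labeling : Set
Labeling = ℕ → ℕ → ℕ

InGrid : ℕ → ℕ → ℕ → ℕ → Set
InGrid m n i j = (1 ≤ i × i ≤ m) × (1 ≤ j × j ≤ n)

IsBijectiveLabeling : ℕ → ℕ → Labeling → Set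
IsBijectiveLabeling m n x =
  (∀ i j → InGrid m n i j → 1 ≤ x i j × x i j ≤ m * n)
  × (∀ i j i' j' → InGrid m n i j → InGrid m n i' j' →
       x i j ≡ x i' j' → (i ≡ i' × j ≡ j'))
  × (∀ k → 1 ≤ k → k ≤ m * n → ∃[ i ] ∃[ j ] (InGrid m n i j × x i j ≡ k))

AllFacesSum : ℕ → ℕ → Labeling → ℕ → Set
AllFacesSum m n x c =
  (∀ i j → 1 ≤ i → i ≤ m ∸ 1 → 1 ≤ j → j ≤ n ∸ 1 →
     x i j + x (suc i) j + x i (suc j) + x (suc i) (suc j) ≡ c)
  × (∀ i → 1 ≤ i → i ≤ m ∸ 1 →
     x i n + x (suc i) n + x (m + 1 ∸ i) 1 + x (m ∸ i) 1 ≡ c)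
  × (∀ j → 1 ≤ j → j ≤ n ∸ 1 →
     x m j + x m (suc j) + x 1 (n + 1 ∸ j) + x 1 (n ∸ j) ≡ c)

IsC4FaceMagicProjective : ℕ → ℕ → Labeling → ℕ → Set
IsC4FaceMagicProjective m n x c = IsBijectiveLabeling m n x × AllFacesSum m n x c

IsEven : ℕ → Bool
IsEven zero = true
IsEven (suc k) = if IsEven k then false else true

-- Bicentrally balanced (for odd m, n): value 2mn+3 and
-- x_{i,j} + x_{m+1-i,n+1-j} = S(i,j), where S(i,j) = (mn+3)/2 if i+j even,
-- (3mn+3)/2 if i+j odd; stated after multiplying by 2 (mn odd, so exact).
BicentrallyBalanced : ℕ → ℕ → Labeling → Set
BicentrallyBalanced m n x =
  IsC4FaceMagicProjective m n x (2 * (m * n) + 3)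
  × (∀ i j → InGrid m n i j →
       2 * (x i j + x (m + 1 ∸ i) (n + 1 ∸ j))
         ≡ (if IsEven (i + j) then m * n + 3 else 3 * (m * n) + 3))

-- Row permutation: for 1 ≤ j ≤ n0, rows j and n+1-j are swapped iff δ j = true.
-- rowIndex n0 δ j gives the row of X whose labels form row j of Z.
rowIndex : ℕ → (ℕ → Bool) → ℕ → ℕ
rowIndex n0 δ j =
  if ⌊ j ≤? n0 ⌋ then (if δ j then (2 * n0 + 2 ∸ j) else j)
  else if ⌊ n0 + 2 ≤? j ⌋ then (if δ (2 * n0 + 2 ∸ j) then (2 * n0 + 2 ∸ j) else j)
  else j

swapRows : ℕ → (ℕ → Bool) → Labeling → Labeling
swapRows n0 δ x i j = x i (rowIndex n0 δ j)

-- A row map σ that sends each row j either to itself or to its mirror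
-- image j* = n + 1 − j, compatibly with the mirror (σ (j*) = (σ j)*),
-- preserves every defining property of a bicentrally balanced labeling.
-- The face sums of consecutive rows pair up as g j + g (j + 1) for a
-- function g of the row index, so g is constant on rows of equal parity;
-- for odd n the rows j and j* have the same parity, hence g (σ j) = g j.
-- Parity of i + j is likewise unchanged, and compatibility with the mirror
-- carries the balance condition over.
module Submission where

open import Defs
open import Data.Nat using (ℕ; zero; suc; _+_; _*_; _∸_; _≤_; _<_; _⊓_; s≤s; z≤n; _≤?_)
open import Data.Nat.Properties
open import Data.Bool using (Bool; true; false; if_then_else_)
open import Data.Bool.Properties using (if-eta)
open import Data.Product using (∃-syntax; _,_; _×_; proj₁; proj₂)
open import Data.Sum using (_⊎_; inj₁; inj₂)
open import Relation.Nullary using (yes; no)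
open import Relation.Binary.PropositionalEquality
open import Data.Nat.Tactic.RingSolver using (solve-∀)

<⇒≤∸1 : ∀ {j n} → j < n → j ≤ n ∸ 1
<⇒≤∸1 (s≤s j≤n) = j≤n

≤∸1⇒< : ∀ {j n} → 1 ≤ n → j ≤ n ∸ 1 → j < n
≤∸1⇒< {n = suc n} _ j≤n = s≤s j≤n

+-suc-double : ∀ a k → a + (suc k + suc k) ≡ suc (suc (a + (k + k)))
+-suc-double = solve-∀

EvenGap : ℕ → ℕ → Set
EvenGap j j' = ∃[ k ] j' ≡ j + (k + k)

double-sum⇒EvenGap : ∀ j j' s → j + j' ≡ s + s → EvenGap j j' ⊎ EvenGap j' j
double-sum⇒EvenGap zero j' s e = inj₁ (s , e)
double-sum⇒EvenGap (suc j) zero s e = inj₂ (s , trans (sym (+-identityʳ (suc j))) e)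
double-sum⇒EvenGap (suc j) (suc j') (suc s) e
  with double-sum⇒EvenGap j j' s (suc-injective (begin
         suc (j + j') ≡⟨ sym (+-suc j j') ⟩
         j + suc j'   ≡⟨ suc-injective e ⟩
         s + suc s    ≡⟨ +-suc s s ⟩
         suc (s + s)  ∎))
  where open ≡-Reasoning
... | inj₁ (k , e') = inj₁ (k , cong suc e')
... | inj₂ (k , e') = inj₂ (k , cong suc e')

IsEven-+-double : ∀ a k → IsEven (a + (k + k)) ≡ IsEven a
IsEven-+-double a zero = cong IsEven (+-identityʳ a)
IsEven-+-double a (suc k) rewrite +-suc-double a k with IsEven (a + (k + k)) | IsEven-+-double a k
... | true  | e = e
... | false | e = e

IsEven-EvenGap : ∀ i {j j'} → EvenGap j j' → IsEven (i + j') ≡ IsEven (i + j)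
IsEven-EvenGap i {j} (k , refl) =
  trans (cong IsEven (sym (+-assoc i j (k + k)))) (IsEven-+-double (i + j) k)

InRange : ℕ → ℕ → Set
InRange n j = 1 ≤ j × j ≤ n

InRange-≤∸1 : ∀ {n j} → 1 ≤ j → j ≤ n ∸ 1 → InRange n j
InRange-≤∸1 {n} 1≤j j≤n-1 = 1≤j , ≤-trans j≤n-1 (m∸n≤m n 1)

InRange-suc-≤∸1 : ∀ {n j} → 1 ≤ n → j ≤ n ∸ 1 → InRange n (suc j)
InRange-suc-≤∸1 1≤n j≤n-1 = s≤s z≤n , ≤∸1⇒< 1≤n j≤n-1

Alternating : ℕ → (ℕ → ℕ) → ℕ → Set
Alternating n f c = ∀ j → 1 ≤ j → j ≤ n ∸ 1 → f j + f (suc j) ≡ c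

module _ {n c : ℕ} {f : ℕ → ℕ} (alt : Alternating n f c) where

  alternating-+2 : ∀ j → 1 ≤ j → suc (suc j) ≤ n → f (suc (suc j)) ≡ f j
  alternating-+2 j 1≤j j+2≤n = +-cancelˡ-≡ (f (suc j)) _ _ (begin
    f (suc j) + f (suc (suc j)) ≡⟨ alt (suc j) (s≤s z≤n) (<⇒≤∸1 j+2≤n) ⟩
    c                           ≡⟨ alt j 1≤j (<⇒≤∸1 (≤-trans (n≤1+n _) j+2≤n)) ⟨
    f j + f (suc j)             ≡⟨ +-comm (f j) _ ⟩
    f (suc j) + f j             ∎)
    where open ≡-Reasoning

  alternating-+-double : ∀ j k → 1 ≤ j → j + (k + k) ≤ n → f (j + (k + k)) ≡ f j
  alternating-+-double j zero _ _ = cong f (+-identityʳ j)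
  alternating-+-double j (suc k) 1≤j bound rewrite +-suc-double j k =
    trans (alternating-+2 (j + (k + k)) (≤-trans 1≤j (m≤m+n j _)) bound)
          (alternating-+-double j k 1≤j (≤-trans (n≤1+n _) (≤-trans (n≤1+n _) bound)))

  alternating-EvenGap : ∀ {j j'} → 1 ≤ j → j' ≤ n → EvenGap j j' → f j' ≡ f j
  alternating-EvenGap {j} 1≤j j'≤n (k , refl) = alternating-+-double j k 1≤j j'≤n

reflect : ℕ → ℕ → ℕ
reflect n j = n + 1 ∸ j

module _ {n : ℕ} where

  reflect-+ : ∀ {j} → j ≤ n → j + reflect n j ≡ n + 1
  reflect-+ j≤n = m+[n∸m]≡n (m≤n⇒m≤n+o 1 j≤n)

  reflect-involutive : ∀ {j} → j ≤ n → reflect n (reflect n j) ≡ j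
  reflect-involutive j≤n = m∸[m∸n]≡n (m≤n⇒m≤n+o 1 j≤n)

  reflect-suc : ∀ j → reflect n (suc j) ≡ n ∸ j
  reflect-suc j = cong (_∸ suc j) (+-comm n 1)

  reflect-range : ∀ {j} → InRange n j → InRange n (reflect n j)
  reflect-range {j} (1≤j , j≤n) =
    m<n⇒0<n∸m (≤-trans (s≤s j≤n) (≤-reflexive (+-comm 1 n))) ,
    ≤-trans (∸-monoʳ-≤ (n + 1) 1≤j) (≤-reflexive (m+n∸n≡m n 1))

module _ {n0 : ℕ} where

  private
    n = 2 * n0 + 1

  reflect-odd-+ : ∀ {j} → j ≤ n → j + reflect n j ≡ suc n0 + suc n0
  reflect-odd-+ j≤n = trans (reflect-+ j≤n) (odd+1≡double n0)
    where
    odd+1≡double : ∀ k → 2 * k + 1 + 1 ≡ suc k + suc k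
    odd+1≡double = solve-∀

  reflect-EvenGap : ∀ {j} → j ≤ n → EvenGap j (reflect n j) ⊎ EvenGap (reflect n j) j
  reflect-EvenGap {j} j≤n = double-sum⇒EvenGap j (reflect n j) (suc n0) (reflect-odd-+ j≤n)

  IsEven-reflect : ∀ i {j} → j ≤ n → IsEven (i + reflect n j) ≡ IsEven (i + j)
  IsEven-reflect i j≤n with reflect-EvenGap j≤n
  ... | inj₁ gap = IsEven-EvenGap i gap
  ... | inj₂ gap = sym (IsEven-EvenGap i gap)

  alternating-reflect : ∀ f {c} → Alternating n f c →
                        ∀ {j} → InRange n j → f (reflect n j) ≡ f j
  alternating-reflect f alt jr@(1≤j , j≤n) with reflect-EvenGap j≤n
  ... | inj₁ gap = alternating-EvenGap {f = f} alt 1≤j (proj₂ (reflect-range jr)) gap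
  ... | inj₂ gap = sym (alternating-EvenGap {f = f} alt (proj₁ (reflect-range jr)) j≤n gap)

  ≤-reflect : ∀ {j} → j ≤ n → j ≤ n0 → j ≤ reflect n j
  ≤-reflect {j} j≤n j≤n0 = +-cancelˡ-≤ j j (reflect n j) (begin
    j + j              ≤⟨ +-mono-≤ (m≤n⇒m≤1+n j≤n0) (m≤n⇒m≤1+n j≤n0) ⟩
    suc n0 + suc n0    ≡⟨ reflect-odd-+ j≤n ⟨
    j + reflect n j    ∎)
    where open ≤-Reasoning

  reflect-≤ : ∀ {j} → j ≤ n → n0 < j → reflect n j ≤ j
  reflect-≤ {j} j≤n n0<j = +-cancelˡ-≤ j (reflect n j) j (begin
    j + reflect n j    ≡⟨ reflect-odd-+ j≤n ⟩
    suc n0 + suc n0    ≤⟨ +-mono-≤ n0<j n0<j ⟩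
    j + j              ∎)
    where open ≤-Reasoning

  reflect-middle : reflect n (suc n0) ≡ suc n0
  reflect-middle = +-cancelˡ-≡ (suc n0) _ _ (reflect-odd-+ middle≤n)
    where
    middle≤n : suc n0 ≤ n
    middle≤n = ≤-trans (≤-reflexive (+-comm 1 n0)) (+-monoˡ-≤ 1 (m≤m+n n0 (n0 + 0)))

IsBijectiveLabeling-reindex : ∀ {m n x} (σ : ℕ → ℕ) →
  (∀ {j} → InRange n j → InRange n (σ j)) →
  (∀ {j} → InRange n j → σ (σ j) ≡ j) →
  IsBijectiveLabeling m n x → IsBijectiveLabeling m n (λ i j → x i (σ j))
IsBijectiveLabeling-reindex {m} {n} {x} σ σ-range σ-involutive (bounded , injective , surjective) =
  (λ i j ij → bounded i (σ j) (onGrid ij)) ,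
  (λ i j i' j' ij ij' e →
     let i≡i' , σj≡σj' = injective i (σ j) i' (σ j') (onGrid ij) (onGrid ij') e
     in i≡i' , (begin
          j        ≡⟨ σ-involutive (proj₂ ij) ⟨
          σ (σ j)  ≡⟨ cong σ σj≡σj' ⟩
          σ (σ j') ≡⟨ σ-involutive (proj₂ ij') ⟩
          j'       ∎)) ,
  λ k 1≤k k≤mn →
     let i , j , ij , e = surjective k 1≤k k≤mn
     in i , σ j , onGrid ij , trans (cong (x i) (σ-involutive (proj₂ ij))) e
  where
  open ≡-Reasoning
  onGrid : ∀ {i j} → InGrid m n i j → InGrid m n i (σ j)
  onGrid (ir , jr) = ir , σ-range jr

columnPair : Labeling → ℕ → ℕ → ℕ
columnPair z i j = z i j + z (suc i) j

mirrorPair : ℕ → ℕ → Labeling → ℕ → ℕ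
mirrorPair m n z j = z m j + z 1 (reflect n j)

module _ {m n : ℕ} (z : Labeling) where

  interiorFace-columnPairs : ∀ i j →
    z i j + z (suc i) j + z i (suc j) + z (suc i) (suc j) ≡ columnPair z i j + columnPair z i (suc j)
  interiorFace-columnPairs i j = +-assoc (columnPair z i j) _ _

  rowWrapFace-columnPairs : ∀ {i} → i ≤ m →
    z i n + z (suc i) n + z (m + 1 ∸ i) 1 + z (m ∸ i) 1 ≡ columnPair z i n + columnPair z (m ∸ i) 1
  rowWrapFace-columnPairs {i} i≤m
    rewrite +-∸-comm 1 i≤m | +-comm (m ∸ i) 1 =
    trans (+-assoc (columnPair z i n) _ _) (cong (columnPair z i n +_) (+-comm _ (z (m ∸ i) 1)))

  columnWrapFace-mirrorPairs : ∀ j →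
    z m j + z m (suc j) + z 1 (n + 1 ∸ j) + z 1 (n ∸ j) ≡ mirrorPair m n z j + mirrorPair m n z (suc j)
  columnWrapFace-mirrorPairs j rewrite sym (reflect-suc {n} j) =
    swap-middle (z m j) (z m (suc j)) (z 1 (reflect n j)) (z 1 (reflect n (suc j)))
    where
    swap-middle : ∀ a b c d → a + b + c + d ≡ (a + c) + (b + d)
    swap-middle = solve-∀

module RowMap {n0 : ℕ} (σ : ℕ → ℕ)
  (fixes-or-reflects : ∀ {j} → InRange (2 * n0 + 1) j → σ j ≡ j ⊎ σ j ≡ reflect (2 * n0 + 1) j)
  (σ-reflect : ∀ {j} → InRange (2 * n0 + 1) j →
                σ (reflect (2 * n0 + 1) j) ≡ reflect (2 * n0 + 1) (σ j))
  where

  private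
    n = 2 * n0 + 1
    1≤n : 1 ≤ n
    1≤n = m≤n+m 1 (2 * n0)

  reindex : Labeling → Labeling
  reindex x i j = x i (σ j)

  σ-range : ∀ {j} → InRange n j → InRange n (σ j)
  σ-range jr with fixes-or-reflects jr
  ... | inj₁ e = subst (InRange n) (sym e) jr
  ... | inj₂ e = subst (InRange n) (sym e) (reflect-range jr)

  σ-involutive : ∀ {j} → InRange n j → σ (σ j) ≡ j
  σ-involutive {j} jr with fixes-or-reflects jr
  ... | inj₁ e = trans (cong σ e) e
  ... | inj₂ e = begin
    σ (σ j)             ≡⟨ cong σ e ⟩
    σ (reflect n j)     ≡⟨ σ-reflect jr ⟩
    reflect n (σ j)     ≡⟨ cong (reflect n) e ⟩
    reflect n (reflect n j) ≡⟨ reflect-involutive (proj₂ jr) ⟩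
    j                   ∎
    where open ≡-Reasoning

  IsEven-σ : ∀ i {j} → InRange n j → IsEven (i + σ j) ≡ IsEven (i + j)
  IsEven-σ i jr with fixes-or-reflects jr
  ... | inj₁ e = cong (λ k → IsEven (i + k)) e
  ... | inj₂ e = trans (cong (λ k → IsEven (i + k)) e) (IsEven-reflect {n0} i (proj₂ jr))

  alternating-σ : ∀ f {c} → Alternating n f c → ∀ {j} → InRange n j → f (σ j) ≡ f j
  alternating-σ f alt jr with fixes-or-reflects jr
  ... | inj₁ e = cong f e
  ... | inj₂ e = trans (cong f e) (alternating-reflect {n0} f alt jr)

  alternating-σ-pair : ∀ f {c} → Alternating n f c →
    ∀ j → 1 ≤ j → j ≤ n ∸ 1 → f (σ j) + f (σ (suc j)) ≡ c
  alternating-σ-pair f {c} alt j 1≤j j≤n-1 = begin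
    f (σ j) + f (σ (suc j)) ≡⟨ cong₂ _+_ (alternating-σ f alt jr) (alternating-σ f alt sjr) ⟩
    f j + f (suc j)         ≡⟨ alt j 1≤j j≤n-1 ⟩
    c                       ∎
    where
    open ≡-Reasoning
    jr : InRange n j
    jr = InRange-≤∸1 1≤j j≤n-1
    sjr : InRange n (suc j)
    sjr = InRange-suc-≤∸1 1≤n j≤n-1

  mirrorPair-reindex : ∀ m x {j} → InRange n j →
    mirrorPair m n (reindex x) j ≡ mirrorPair m n x (σ j)
  mirrorPair-reindex m x {j} jr = cong (λ k → x m (σ j) + x 1 k) (σ-reflect jr)

  module _ {m c : ℕ} {x : Labeling} where

    columnPair-alternating : AllFacesSum m n x c →
      ∀ i → 1 ≤ i → i ≤ m ∸ 1 → Alternating n (columnPair x i) c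
    columnPair-alternating (interior , _) i 1≤i i≤m-1 j 1≤j j≤n-1 =
      trans (sym (interiorFace-columnPairs {m} {n} x i j)) (interior i j 1≤i i≤m-1 1≤j j≤n-1)

    mirrorPair-alternating : AllFacesSum m n x c → Alternating n (mirrorPair m n x) c
    mirrorPair-alternating (_ , _ , columnWrap) j 1≤j j≤n-1 =
      trans (sym (columnWrapFace-mirrorPairs {m} {n} x j)) (columnWrap j 1≤j j≤n-1)

    reindex-interiorFaces : AllFacesSum m n x c →
      ∀ i j → 1 ≤ i → i ≤ m ∸ 1 → 1 ≤ j → j ≤ n ∸ 1 →
      reindex x i j + reindex x (suc i) j + reindex x i (suc j) + reindex x (suc i) (suc j) ≡ c
    reindex-interiorFaces faces i j 1≤i i≤m-1 1≤j j≤n-1 =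
      trans (interiorFace-columnPairs {m} {n} (reindex x) i j)
            (alternating-σ-pair (columnPair x i) (columnPair-alternating faces i 1≤i i≤m-1)
                                j 1≤j j≤n-1)

    reindex-rowWrapFaces : AllFacesSum m n x c → ∀ i → 1 ≤ i → i ≤ m ∸ 1 →
      reindex x i n + reindex x (suc i) n + reindex x (m + 1 ∸ i) 1 + reindex x (m ∸ i) 1 ≡ c
    reindex-rowWrapFaces faces@(_ , rowWrap , _) i 1≤i i≤m-1 = begin
      reindex x i n + reindex x (suc i) n + reindex x (m + 1 ∸ i) 1 + reindex x (m ∸ i) 1
        ≡⟨ rowWrapFace-columnPairs {m} {n} (reindex x) i≤m ⟩
      columnPair x i (σ n) + columnPair x (m ∸ i) (σ 1)
        ≡⟨ cong₂ _+_ (alternating-σ (columnPair x i) (columnPair-alternating faces i 1≤i i≤m-1) n∈n)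
                     (alternating-σ (columnPair x (m ∸ i))
                                    (columnPair-alternating faces (m ∸ i) 1≤m-i m-i≤m-1) 1∈n) ⟩
      columnPair x i n + columnPair x (m ∸ i) 1
        ≡⟨ rowWrapFace-columnPairs {m} {n} x i≤m ⟨
      x i n + x (suc i) n + x (m + 1 ∸ i) 1 + x (m ∸ i) 1
        ≡⟨ rowWrap i 1≤i i≤m-1 ⟩
      c ∎
      where
      open ≡-Reasoning
      i≤m : i ≤ m
      i≤m = ≤-trans i≤m-1 (m∸n≤m m 1)
      1≤m-i : 1 ≤ m ∸ i
      1≤m-i = m<n⇒0<n∸m (≤∸1⇒< (≤-trans 1≤i i≤m) i≤m-1)
      m-i≤m-1 : m ∸ i ≤ m ∸ 1
      m-i≤m-1 = ∸-monoʳ-≤ m 1≤i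
      1∈n : InRange n 1
      1∈n = ≤-refl , 1≤n
      n∈n : InRange n n
      n∈n = 1≤n , ≤-refl

    reindex-columnWrapFaces : AllFacesSum m n x c → ∀ j → 1 ≤ j → j ≤ n ∸ 1 →
      reindex x m j + reindex x m (suc j) + reindex x 1 (n + 1 ∸ j) + reindex x 1 (n ∸ j) ≡ c
    reindex-columnWrapFaces faces j 1≤j j≤n-1 = begin
      reindex x m j + reindex x m (suc j) + reindex x 1 (n + 1 ∸ j) + reindex x 1 (n ∸ j)
        ≡⟨ columnWrapFace-mirrorPairs {m} {n} (reindex x) j ⟩
      mirrorPair m n (reindex x) j + mirrorPair m n (reindex x) (suc j)
        ≡⟨ cong₂ _+_ (mirrorPair-reindex m x (InRange-≤∸1 1≤j j≤n-1))
                     (mirrorPair-reindex m x (InRange-suc-≤∸1 1≤n j≤n-1)) ⟩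
      mirrorPair m n x (σ j) + mirrorPair m n x (σ (suc j))
        ≡⟨ alternating-σ-pair (mirrorPair m n x) (mirrorPair-alternating faces) j 1≤j j≤n-1 ⟩
      c ∎
      where open ≡-Reasoning

    reindex-faces : AllFacesSum m n x c → AllFacesSum m n (reindex x) c
    reindex-faces faces =
      reindex-interiorFaces faces , reindex-rowWrapFaces faces , reindex-columnWrapFaces faces

  reindex-balanced : ∀ {m x} → BicentrallyBalanced m n x → BicentrallyBalanced m n (reindex x)
  reindex-balanced {m} {x} ((bijective , faces) , balanced) =
    (IsBijectiveLabeling-reindex σ σ-range σ-involutive bijective , reindex-faces {m} {x = x} faces) ,
    λ i j (ir , jr) → begin
      2 * (x i (σ j) + x (m + 1 ∸ i) (σ (reflect n j)))
        ≡⟨ cong (λ k → 2 * (x i (σ j) + x (m + 1 ∸ i) k)) (σ-reflect jr) ⟩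
      2 * (x i (σ j) + x (m + 1 ∸ i) (reflect n (σ j)))
        ≡⟨ balanced i (σ j) (ir , σ-range jr) ⟩
      (if IsEven (i + σ j) then m * n + 3 else 3 * (m * n) + 3)
        ≡⟨ cong (λ b → if b then m * n + 3 else 3 * (m * n) + 3) (IsEven-σ i jr) ⟩
      (if IsEven (i + j) then m * n + 3 else 3 * (m * n) + 3) ∎
    where open ≡-Reasoning

module _ {n0 : ℕ} where

  private
    n = 2 * n0 + 1

  reflect-odd : ∀ j → reflect n j ≡ 2 * n0 + 2 ∸ j
  reflect-odd j = cong (_∸ j) (+-assoc (2 * n0) 1 1)

  rowIndex-spec : ∀ δ {j} → InRange n j →
    rowIndex n0 δ j ≡ (if δ (j ⊓ reflect n j) then reflect n j else j)
  rowIndex-spec δ {j} (_ , j≤n) with j ≤? n0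
  ... | yes j≤n0 rewrite m≤n⇒m⊓n≡m (≤-reflect j≤n j≤n0) | reflect-odd j = refl
  ... | no j≰n0 rewrite m≥n⇒m⊓n≡n (reflect-≤ j≤n (≰⇒> j≰n0)) with n0 + 2 ≤? j
  ...   | yes _ rewrite reflect-odd j = refl
  ...   | no j≱n0+2 = sym (trans (cong (λ k → if δ k then k else j) reflect-fixed) (if-eta (δ j)))
    where
    j≡middle : j ≡ suc n0
    j≡middle = ≤-antisym (≤-pred (≤-trans (≰⇒> j≱n0+2) (≤-reflexive (+-comm n0 2)))) (≰⇒> j≰n0)
    reflect-fixed : reflect n j ≡ j
    reflect-fixed = trans (cong (reflect n) j≡middle) (trans reflect-middle (sym j≡middle))

  rowIndex-fixes-or-reflects : ∀ δ {j} → InRange n j →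
    rowIndex n0 δ j ≡ j ⊎ rowIndex n0 δ j ≡ reflect n j
  rowIndex-fixes-or-reflects δ {j} jr with δ (j ⊓ reflect n j) | rowIndex-spec δ jr
  ... | true  | e = inj₂ e
  ... | false | e = inj₁ e

  rowIndex-reflect : ∀ δ {j} → InRange n j →
    rowIndex n0 δ (reflect n j) ≡ reflect n (rowIndex n0 δ j)
  rowIndex-reflect δ {j} jr = begin
    rowIndex n0 δ (reflect n j)
      ≡⟨ rowIndex-spec δ (reflect-range jr) ⟩
    (if δ (reflect n j ⊓ reflect n (reflect n j)) then reflect n (reflect n j) else reflect n j)
      ≡⟨ cong₂ (λ a b → if δ a then b else reflect n j)
               (trans (cong (reflect n j ⊓_) reflect²) (⊓-comm _ j)) reflect² ⟩
    (if δ (j ⊓ reflect n j) then j else reflect n j)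
      ≡⟨ reflect-if (δ (j ⊓ reflect n j)) ⟩
    reflect n (if δ (j ⊓ reflect n j) then reflect n j else j)
      ≡⟨ cong (reflect n) (rowIndex-spec δ jr) ⟨
    reflect n (rowIndex n0 δ j) ∎
    where
    open ≡-Reasoning
    reflect² : reflect n (reflect n j) ≡ j
    reflect² = reflect-involutive (proj₂ jr)
    reflect-if : ∀ b → (if b then j else reflect n j) ≡ reflect n (if b then reflect n j else j)
    reflect-if true  = sym reflect²
    reflect-if false = refl

lemma26 : (m n n0 : ℕ) → 3 ≤ m → 3 ≤ n → (∃[ m0 ] m ≡ 2 * m0 + 1) → n ≡ 2 * n0 + 1 →
    (x : Labeling) → BicentrallyBalanced m n x →
    (δ : ℕ → Bool) → BicentrallyBalanced m n (swapRows n0 δ x)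
lemma26 m _ n0 _ _ _ refl x balanced δ =
  RowMap.reindex-balanced {n0} (rowIndex n0 δ)
    (rowIndex-fixes-or-reflects δ) (rowIndex-reflect δ) balanced
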